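{- Let $r\ge 2$ and $t\ge1$ be integers and let $F$ be a graph. Then for every $n$, $$ex(n,K_r,F)\le ex_r(n,\mathbb{H}_t^rF)\le ex_r(n,\mathbb{B}_t^rF)\le ex(n,K_r,F)+ex(n,F)+(t-1)\binom{n}{2}.$$
   Context: A hypergraph consists of a finite vertex set and a set of distinct subsets of it (hyperedges); it is $r$-uniform if all hyperedges have size $r$. For an integer $t\ge1$ and a graph $F$, a hypergraph $\mathcal{F}$ is a $t$-heavy copy of $F$ if there exist an injection $i:V(F)\to V(\mathcal{F})$ and a map $h$ assigning to each edge $e$ of $F$ a set $h(e)$ of $t$ distinct hyperedges of $\mathcal{F}$ such that for every edge $e=xy$ of $F$, $\{i(x),i(y)\}\subseteq A$ for all $A\in h(e)$. It is a $t$-wise Berge copy if moreover $|E(\mathcal{F})|=t|E(F)|$ and such $i,h$ exist with $h(e)\cap h(e')=\emptyset$ for distinct edges $e,e'$. $\mathbb{H}_t^rF$, $\mathbb{B}_t^rF$ are the families of $r$-uniform $t$-heavy, resp. $t$-wise Berge, copies of $F$. $ex_r(n,\mathbb{F})$ is the maximum number of hyperedges in an $r$-uniform hypergraph on $n$ vertices containing no member of $\mathbb{F}$ as a subhypergraph. $ex(n,F)$ is the maximum number of edges in an $F$-free graph on $n$ vertices, and $ex(n,K_r,F)$ is the maximum number of copies of $K_r$ in an $F$-free graph on $n$ vertices. -}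

module Defs where

open import Data.Nat using (ℕ; zero; suc; _≤_; _*_)
open import Data.Bool using (Bool; true; false; _∧_; _∨_; not; if_then_else_)
open import Data.Fin using (Fin; _<?_; _≟_)
open import Data.Fin.Subset using (Subset; ∣_∣; _∈_; inside; outside)
open import Data.List using (List; []; _∷_; length; filterᵇ; map; _++_; cartesianProduct)
open import Data.Bool.ListAction using (all)
open import Data.List.Membership.Propositional renaming (_∈_ to _∈L_)
open import Data.List.Relation.Unary.All using (All)
open import Data.List.Relation.Unary.Unique.Propositional using (Unique)
open import Data.Vec using (Vec; []; _∷_; lookup)
open import Data.Vec.Functional using () renaming (Vector to FVec)
open import Data.Fin.Base using (toℕ)
open import Data.Product using (Σ; _×_; _,_; proj₁; proj₂)
open import Data.Empty using (⊥)
open import Relation.Nullary using (¬_)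
open import Relation.Nullary.Decidable using (⌊_⌋)
open import Relation.Binary.PropositionalEquality using (_≡_; _≢_)
open import Function.Definitions using (Injective)
open import Data.List using () renaming (allFin to allFinL)

record Graph (k : ℕ) : Set where
  field
    adj   : Fin k → Fin k → Bool
    sym   : ∀ x y → adj x y ≡ adj y x
    irrefl : ∀ x → adj x x ≡ false
open Graph public

edgeList : ∀ {k} → Graph k → List (Fin k × Fin k)
edgeList {k} G =
  filterᵇ (λ p → ⌊ proj₁ p <? proj₂ p ⌋ ∧ adj G (proj₁ p) (proj₂ p))
         (cartesianProduct (allFinL k) (allFinL k))

numEdges : ∀ {k} → Graph k → ℕ
numEdges G = length (edgeList G)

edgeAt : ∀ {k} (G : Graph k) → Fin (numEdges G) → Fin k × Fin k
edgeAt G e = Data.List.lookup (edgeList G) e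

allSubsets : (n : ℕ) → List (Subset n)
allSubsets zero = [] ∷ []
allSubsets (suc n) = map (inside ∷_) (allSubsets n) ++ map (outside ∷_) (allSubsets n)

memb : ∀ {n} → Fin n → Subset n → Bool
memb x S = lookup S x

isClique : ∀ {n} → Graph n → Subset n → Bool
isClique {n} G S =
  all (λ x → all (λ y → not (memb x S) ∨ not (memb y S) ∨ ⌊ x ≟ y ⌋ ∨ adj G x y) (allFinL n)) (allFinL n)

numCliques : ∀ {n} → ℕ → Graph n → ℕ
numCliques {n} r G =
  length (filterᵇ (λ S → ⌊ Data.Nat._≟_ ∣ S ∣ r ⌋ ∧ isClique G S) (allSubsets n))

ContainsGraph : ∀ {k n} → Graph k → Graph n → Set
ContainsGraph {k} {n} F G =
  Σ (Fin k → Fin n) λ φ → Injective _≡_ _≡_ φ ×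
    (∀ x y → adj F x y ≡ true → adj G (φ x) (φ y) ≡ true)

record UHyp (n r : ℕ) : Set where
  field
    hedges : List (Subset n)
    distinct : Unique hedges
    uniform : All (λ A → ∣ A ∣ ≡ r) hedges
open UHyp public

HeavyCopyIn : ∀ {k n r} (t : ℕ) (F : Graph k) → UHyp n r → List (Subset n) →
              (Fin k → Fin n) → (Fin (numEdges F) → List (Subset n)) → Set
HeavyCopyIn {k} {n} t F H E i h =
  All (_∈L hedges H) E × Unique E × Injective _≡_ _≡_ i ×
  (∀ e → length (h e) ≡ t × Unique (h e) × All (_∈L E) (h e) ×
         All (λ A → i (proj₁ (edgeAt F e)) ∈ A × i (proj₂ (edgeAt F e)) ∈ A) (h e))

ContainsHeavy : ∀ {k n r} → ℕ → Graph k → UHyp n r → Set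
ContainsHeavy {k} {n} t F H =
  Σ (List (Subset n)) λ E → Σ (Fin k → Fin n) λ i →
  Σ (Fin (numEdges F) → List (Subset n)) λ h → HeavyCopyIn t F H E i h

ContainsBerge : ∀ {k n r} → ℕ → Graph k → UHyp n r → Set
ContainsBerge {k} {n} t F H =
  Σ (List (Subset n)) λ E → Σ (Fin k → Fin n) λ i →
  Σ (Fin (numEdges F) → List (Subset n)) λ h → HeavyCopyIn t F H E i h ×
    length E ≡ t * numEdges F ×
    (∀ e e′ → e ≢ e′ → ∀ A → A ∈L h e → ¬ (A ∈L h e′))

IsMaximum : (ℕ → Set) → ℕ → Set
IsMaximum P m = P m × (∀ c → P c → c ≤ m)

IsEx : ∀ {k} → ℕ → Graph k → ℕ → Set
IsEx n F = IsMaximum (λ c → Σ (Graph n) λ G → ¬ ContainsGraph F G × numEdges G ≡ c)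

IsExClique : ∀ {k} → ℕ → ℕ → Graph k → ℕ → Set
IsExClique n r F = IsMaximum (λ c → Σ (Graph n) λ G → ¬ ContainsGraph F G × numCliques r G ≡ c)

IsExHeavy : ∀ {k} → ℕ → ℕ → ℕ → Graph k → ℕ → Set
IsExHeavy n r t F = IsMaximum (λ c → Σ (UHyp n r) λ H → ¬ ContainsHeavy t F H × length (hedges H) ≡ c)

IsExBerge : ∀ {k} → ℕ → ℕ → ℕ → Graph k → ℕ → Set
IsExBerge n r t F = IsMaximum (λ c → Σ (UHyp n r) λ H → ¬ ContainsBerge t F H × length (hedges H) ≡ c)

-- Two of the inequalities are immediate: the r-cliques of an F-free graph form an r-uniform
-- hypergraph with no t-heavy copy of F (a heavy copy puts every edge of F inside some clique),
-- and every t-wise Berge copy is a t-heavy copy.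
--
-- For the third, let H be Berge-F-free and go through its hyperedges, assigning each one to a
-- pair of its vertices that has so far received fewer than t hyperedges, if there is such a pair.
-- Let G be the graph of the saturated pairs, those that received t hyperedges. An unassigned
-- hyperedge has all its pairs saturated, so it is an r-clique of G. The assigned hyperedges
-- number at most t per edge of G and t - 1 per other pair, that is at most |E(G)| + (t - 1) C(n,2).
-- Finally G is F-free: for a copy of F in G, the hyperedges assigned to the images of its edges
-- form a t-wise Berge copy of F in H.
module Submission where

open import Defs hiding (sym)
open import Data.Nat using (ℕ; _≤_; _+_; _*_; _∸_)
open import Data.Nat.Combinatorics using (_C_)
open import Data.Product using (_×_)

open import Data.Bool using (Bool; true; false; T; not; _∧_; _∨_; if_then_else_)
open import Data.Bool.ListAction using (all)
open import Data.Bool.Properties using (T-≡; T-∧; T-∨; ∨-comm)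
open import Data.Empty using (⊥-elim)
open import Data.Fin as Fin using (Fin; zero; suc)
open import Data.Fin.Properties using (<-cmp; <-asym; <-irrefl)
open import Data.Fin.Subset using (Subset; ∣_∣; inside; outside) renaming (_∈_ to _∈ₛ_)
open import Data.Fin.Subset.Properties using () renaming (_∈?_ to _∈ₛ?_)
open import Data.List using (List; []; _∷_; length; map; filter; filterᵇ; _++_; concatMap;
  cartesianProduct; lookup; allFin)
open import Data.List.Membership.Propositional using (_∈_; find; lose)
open import Data.List.Membership.Propositional.Properties using (∈-lookup; ∈-map⁺; ∈-map⁻; ∈-++⁺ˡ;
  ∈-++⁺ʳ; ∈-++⁻; ∈-∃++; ∈-allFin; ∈-filter⁺; ∈-filter⁻; ∈-map∘filter⁻; ∈-concat⁺′;
  ∈-cartesianProduct⁺)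
open import Data.List.Properties using (length-map; length-++; length-++-sucʳ; length-tabulate;
  map-∘; map-cong; map-tabulate; filter-++; filter-all; filter-none)
open import Data.List.Relation.Binary.Subset.Propositional using (_⊆_)
open import Data.List.Relation.Binary.Subset.Propositional.Properties using (⊆-trans; xs⊆x∷xs; ∷⁺ʳ)
open import Data.List.Relation.Unary.All as All using (All; []; _∷_)
open import Data.List.Relation.Unary.All.Properties using (all⁺; all⁻)
  renaming (map⁺ to All-map⁺; concat⁺ to All-concat⁺)
open import Data.List.Relation.Unary.AllPairs using ([]; _∷_)
import Data.List.Relation.Unary.AllPairs.Properties as AllPairs
open import Data.List.Relation.Unary.Any using (here; there; any?; index)
open import Data.List.Relation.Unary.Any.Properties using (lookup-index)
open import Data.List.Relation.Unary.Unique.Propositional using (Unique)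
import Data.List.Relation.Unary.Unique.Propositional.Properties as Unique
open import Data.Nat as ℕ using (z≤n; s≤s; _<_; _≤?_; _<?_)
open import Data.Nat.Combinatorics using (nC1≡n; nCk+nC[k+1]≡[n+1]C[k+1])
open import Data.Nat.ListAction using (sum)
open import Data.Nat.Properties using (≤-trans; ≤-reflexive; ≤-antisym; +-mono-≤; +-monoˡ-≤; +-suc;
  +-comm; +-assoc; *-comm; *-zeroʳ; m+[n∸m]≡n; <⇒≤pred; ≰⇒>; ≮⇒≥; m≤n+m; module ≤-Reasoning;
  +-commutativeSemigroup)
open import Algebra.Properties.CommutativeSemigroup +-commutativeSemigroup using (interchange)
open import Data.Product using (∃; ∃-syntax; _,_; proj₁; proj₂; swap)
open import Data.Product.Properties using (,-injective; ≡-dec)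
open import Data.Sum using (_⊎_; inj₁; inj₂)
open import Data.Vec as Vec using ()
open import Data.Vec.Properties using ([]=⇒lookup; lookup⇒[]=; ∷-injectiveʳ)
open import Function using (_∘_; id)
open import Function.Bundles using (Equivalence)
open import Function.Definitions using (Injective)
open import Level using (Level)
open import Relation.Binary.Core using (Rel)
open import Relation.Binary.Definitions using (DecidableEquality; Symmetric; tri<; tri≈; tri>)
open import Relation.Binary.PropositionalEquality using (_≡_; _≢_; refl; sym; trans; cong; cong₂;
  subst; subst₂; module ≡-Reasoning)
open import Relation.Nullary using (¬_; yes; no; does; _×-dec_; contradiction)
open import Relation.Nullary.Decidable using (⌊_⌋; T?; dec-true; dec-false; toWitness; fromWitness;
  isYes≗does)
open import Relation.Unary using (Pred; Decidable)

private
  variable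
    a b p q ℓ : Level
    A : Set a
    B : Set b

lookup-injective : ∀ {xs : List A} → Unique xs → ∀ i j → lookup xs i ≡ lookup xs j → i ≡ j
lookup-injective (_ ∷ _) zero zero _ = refl
lookup-injective (x∉xs ∷ _) zero (suc j) eq = contradiction eq (All.lookup x∉xs (∈-lookup j))
lookup-injective (x∉xs ∷ _) (suc i) zero eq = contradiction (sym eq) (All.lookup x∉xs (∈-lookup i))
lookup-injective (_ ∷ u) (suc i) (suc j) eq = cong suc (lookup-injective u i j eq)

Unique-map-injective : ∀ (f : A → B) {xs x y} → Unique (map f xs) → x ∈ xs → y ∈ xs → f x ≡ f y → x ≡ y
Unique-map-injective f _ (here refl) (here refl) _ = refl
Unique-map-injective f (fx∉ ∷ _) (here refl) (there y∈) eq =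
  contradiction eq (All.lookup fx∉ (∈-map⁺ f y∈))
Unique-map-injective f (fy∉ ∷ _) (there x∈) (here refl) eq =
  contradiction (sym eq) (All.lookup fy∉ (∈-map⁺ f x∈))
Unique-map-injective f (_ ∷ u) (there x∈) (there y∈) eq = Unique-map-injective f u x∈ y∈ eq

Unique-map-filter : ∀ {P : Pred A p} (P? : Decidable P) (f : A → B) {xs} →
                    Unique (map f xs) → Unique (map f (filter P? xs))
Unique-map-filter P? f = AllPairs.map⁺ ∘ AllPairs.filter⁺ P? ∘ AllPairs.map⁻

Unique-⊆⇒length≤ : ∀ {xs ys : List A} → Unique xs → xs ⊆ ys → length xs ≤ length ys
Unique-⊆⇒length≤ {xs = []} _ _ = z≤n
Unique-⊆⇒length≤ {xs = x ∷ xs} (x∉xs ∷ u) x∷xs⊆ys with zs , ws , refl ← ∈-∃++ (x∷xs⊆ys (here refl)) =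
  ≤-trans (s≤s (Unique-⊆⇒length≤ u xs⊆zs++ws)) (≤-reflexive (sym (length-++-sucʳ zs x ws)))
  where
  xs⊆zs++ws : xs ⊆ zs ++ ws
  xs⊆zs++ws {y} y∈xs with ∈-++⁻ zs (x∷xs⊆ys (there y∈xs))
  ... | inj₁ y∈zs = ∈-++⁺ˡ y∈zs
  ... | inj₂ (here refl) = contradiction refl (All.lookup x∉xs y∈xs)
  ... | inj₂ (there y∈ws) = ∈-++⁺ʳ zs y∈ws

All⇒∃ : ∀ {P : Pred A p} {xs} → 0 < length xs → All P xs → ∃ P
All⇒∃ _ (px ∷ _) = _ , px

length-concatMap : ∀ (f : A → List B) {c} → (∀ x → length (f x) ≡ c) →
                   ∀ xs → length (concatMap f xs) ≡ length xs * c
length-concatMap f same [] = refl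
length-concatMap f {c} same (x ∷ xs) = begin
  length (f x ++ concatMap f xs)        ≡⟨ length-++ (f x) ⟩
  length (f x) + length (concatMap f xs) ≡⟨ cong₂ _+_ (same x) (length-concatMap f same xs) ⟩
  c + length xs * c                     ∎
  where open ≡-Reasoning

length-filter-map : ∀ {P : Pred B p} {Q : Pred A q} (P? : Decidable P) (Q? : Decidable Q) (f : A → B) →
                    (∀ x → does (P? (f x)) ≡ does (Q? x)) →
                    ∀ xs → length (filter P? (map f xs)) ≡ length (filter Q? xs)
length-filter-map P? Q? f same [] = refl
length-filter-map P? Q? f same (x ∷ xs) with does (P? (f x)) | does (Q? x) | same x
... | true  | true  | refl = cong ℕ.suc (length-filter-map P? Q? f same xs)
... | false | false | refl = length-filter-map P? Q? f same xs

length-filter-cartesianProduct :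
  ∀ {P : Pred (A × B) p} (P? : Decidable P) xs ys →
  length (filter P? (cartesianProduct xs ys)) ≡ sum (map (λ x → length (filter (λ y → P? (x , y)) ys)) xs)
length-filter-cartesianProduct P? [] ys = refl
length-filter-cartesianProduct P? (x ∷ xs) ys = begin
  length (filter P? (map (x ,_) ys ++ cartesianProduct xs ys))
    ≡⟨ cong length (filter-++ P? (map (x ,_) ys) (cartesianProduct xs ys)) ⟩
  length (filter P? (map (x ,_) ys) ++ filter P? (cartesianProduct xs ys))
    ≡⟨ length-++ (filter P? (map (x ,_) ys)) ⟩
  length (filter P? (map (x ,_) ys)) + length (filter P? (cartesianProduct xs ys))
    ≡⟨ cong₂ _+_ (length-filter-map P? (λ y → P? (x , y)) (x ,_) (λ _ → refl) ys)
                 (length-filter-cartesianProduct P? xs ys) ⟩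
  length (filter (λ y → P? (x , y)) ys) + sum (map (λ x → length (filter (λ y → P? (x , y)) ys)) xs)
    ∎
  where open ≡-Reasoning

indicator : Bool → ℕ
indicator true = 1
indicator false = 0

length-filter≡sum : ∀ {P : Pred A p} (P? : Decidable P) xs →
                    length (filter P? xs) ≡ sum (map (λ x → indicator (does (P? x))) xs)
length-filter≡sum P? [] = refl
length-filter≡sum P? (x ∷ xs) with does (P? x)
... | true  = cong ℕ.suc (length-filter≡sum P? xs)
... | false = length-filter≡sum P? xs

sum-map-+ : ∀ (f g : A → ℕ) xs → sum (map (λ x → f x + g x) xs) ≡ sum (map f xs) + sum (map g xs)
sum-map-+ f g [] = refl
sum-map-+ f g (x ∷ xs) = trans (cong (f x + g x +_) (sum-map-+ f g xs)) (interchange (f x) (g x) _ _)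

sum-map-const : ∀ c (xs : List A) → sum (map (λ _ → c) xs) ≡ length xs * c
sum-map-const c [] = refl
sum-map-const c (x ∷ xs) = cong (c +_) (sum-map-const c xs)

sum-map-mono : ∀ {f g : A → ℕ} → (∀ x → f x ≤ g x) → ∀ xs → sum (map f xs) ≤ sum (map g xs)
sum-map-mono f≤g [] = z≤n
sum-map-mono f≤g (x ∷ xs) = +-mono-≤ (f≤g x) (sum-map-mono f≤g xs)

module Occurrences (_≟_ : DecidableEquality A) where

  count : A → List A → ℕ
  count x xs = length (filter (_≟ x) xs)

  count-∷ : ∀ x y ys → count x (y ∷ ys) ≡ indicator (does (y ≟ x)) + count x ys
  count-∷ x y ys with does (y ≟ x)
  ... | true  = refl
  ... | false = refl

  count-≤-∷ : ∀ x y ys → count x ys ≤ count x (y ∷ ys)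
  count-≤-∷ x y ys = ≤-trans (m≤n+m _ _) (≤-reflexive (sym (count-∷ x y ys)))

  length-filter-≟-unique : ∀ {x xs} → Unique xs → x ∈ xs → length (filter (x ≟_) xs) ≡ 1
  length-filter-≟-unique {x} {_ ∷ xs} (x∉xs ∷ _) (here refl) with x ≟ x
  ... | yes _   = cong (ℕ.suc ∘ length) (filter-none (x ≟_) x∉xs)
  ... | no x≢x = contradiction refl x≢x
  length-filter-≟-unique {x} {y ∷ _} (y∉xs ∷ u) (there x∈xs) with x ≟ y
  ... | yes refl = contradiction refl (All.lookup y∉xs x∈xs)
  ... | no _     = length-filter-≟-unique u x∈xs

  sum-count : ∀ {xs ys} → Unique xs → All (_∈ xs) ys → sum (map (λ x → count x ys) xs) ≡ length ys
  sum-count {xs} _ [] = trans (sum-map-const 0 xs) (*-zeroʳ (length xs))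
  sum-count {xs} {y ∷ ys} u (y∈xs ∷ ys⊆xs) = begin
    sum (map (λ x → count x (y ∷ ys)) xs)
      ≡⟨ cong sum (map-cong (λ x → count-∷ x y ys) xs) ⟩
    sum (map (λ x → indicator (does (y ≟ x)) + count x ys) xs)
      ≡⟨ sum-map-+ (λ x → indicator (does (y ≟ x))) (λ x → count x ys) xs ⟩
    sum (map (λ x → indicator (does (y ≟ x))) xs) + sum (map (λ x → count x ys) xs)
      ≡⟨ cong₂ _+_ (trans (sym (length-filter≡sum (y ≟_) xs)) (length-filter-≟-unique u y∈xs))
                   (sum-count u ys⊆xs) ⟩
    ℕ.suc (length ys)
      ∎
    where open ≡-Reasoning

Pair : ℕ → Set
Pair n = Fin n × Fin n

_≟ₚ_ : ∀ {n} → DecidableEquality (Pair n)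
_≟ₚ_ = ≡-dec Fin._≟_ Fin._≟_

Ordered : ∀ {n} → Pred (Pair n) _
Ordered p = proj₁ p Fin.< proj₂ p

ordered? : ∀ {n} → Decidable (Ordered {n})
ordered? p = proj₁ p Fin.<? proj₂ p

allPairs : ∀ n → List (Pair n)
allPairs n = cartesianProduct (allFin n) (allFin n)

allPairs-unique : ∀ n → Unique (allPairs n)
allPairs-unique n = Unique.cartesianProduct⁺ (Unique.allFin⁺ n) (Unique.allFin⁺ n)

∈-allPairs : ∀ {n} (x y : Fin n) → (x , y) ∈ allPairs n
∈-allPairs x y = ∈-cartesianProduct⁺ (∈-allFin x) (∈-allFin y)

pairs : ∀ n → List (Pair n)
pairs n = filter ordered? (allPairs n)

pairs-unique : ∀ n → Unique (pairs n)
pairs-unique n = Unique.filter⁺ ordered? {allPairs n} (allPairs-unique n)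

∈-pairs⁺ : ∀ {n} {x y : Fin n} → x Fin.< y → (x , y) ∈ pairs n
∈-pairs⁺ {x = x} {y} = ∈-filter⁺ ordered? (∈-allPairs x y)

∈-pairs⁻ : ∀ {n} {p : Pair n} → p ∈ pairs n → Ordered p
∈-pairs⁻ {n} = proj₂ ∘ ∈-filter⁻ ordered? {xs = allPairs n}

#above : ∀ {n} → Fin n → ℕ
#above {n} x = length (filter (x Fin.<?_) (allFin n))

allFin-suc : ∀ n → allFin (ℕ.suc n) ≡ zero ∷ map suc (allFin n)
allFin-suc n = cong (zero ∷_) (sym (map-tabulate id suc))

#above-zero : ∀ n → #above (zero {n}) ≡ n
#above-zero n = begin
  length (filter (zero {n} Fin.<?_) (allFin (ℕ.suc n)))
    ≡⟨ cong (length ∘ filter (zero {n} Fin.<?_)) (allFin-suc n) ⟩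
  length (filter (zero {n} Fin.<?_) (map suc (allFin n)))
    ≡⟨ cong length (filter-all (zero {n} Fin.<?_) (All-map⁺ (All.universal (λ _ → s≤s z≤n) (allFin n)))) ⟩
  length (map suc (allFin n))
    ≡⟨ length-map suc (allFin n) ⟩
  length (allFin n)
    ≡⟨ length-tabulate id ⟩
  n ∎
  where open ≡-Reasoning

#above-suc : ∀ {n} (x : Fin n) → #above (suc x) ≡ #above x
#above-suc {n} x = begin
  length (filter (suc x Fin.<?_) (allFin (ℕ.suc n)))
    ≡⟨ cong (length ∘ filter (suc x Fin.<?_)) (allFin-suc n) ⟩
  length (filter (suc x Fin.<?_) (map suc (allFin n)))
    ≡⟨ length-filter-map (suc x Fin.<?_) (x Fin.<?_) suc (λ _ → refl) (allFin n) ⟩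
  length (filter (x Fin.<?_) (allFin n)) ∎
  where open ≡-Reasoning

sum-#above : ∀ n → sum (map #above (allFin n)) ≡ n C 2
sum-#above ℕ.zero = refl
sum-#above (ℕ.suc n) = begin
  sum (map #above (allFin (ℕ.suc n)))            ≡⟨ cong (sum ∘ map #above) (allFin-suc n) ⟩
  #above (zero {n}) + sum (map #above (map suc (allFin n)))
    ≡⟨ cong₂ _+_ (#above-zero n) (cong sum (sym (map-∘ (allFin n)))) ⟩
  n + sum (map (#above ∘ suc) (allFin n))
    ≡⟨ cong (n +_) (cong sum (map-cong #above-suc (allFin n))) ⟩
  n + sum (map #above (allFin n))                ≡⟨ cong (n +_) (sum-#above n) ⟩
  n + n C 2                                      ≡⟨ cong (_+ n C 2) (nC1≡n n) ⟨
  n C 1 + n C 2                                  ≡⟨ nCk+nC[k+1]≡[n+1]C[k+1] n 1 ⟩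
  ℕ.suc n C 2                                    ∎
  where open ≡-Reasoning

length-pairs : ∀ n → length (pairs n) ≡ n C 2
length-pairs n = trans (length-filter-cartesianProduct ordered? (allFin n) (allFin n)) (sum-#above n)

sort : ∀ {n} → Fin n → Fin n → Pair n
sort x y = if does (x Fin.<? y) then (x , y) else (y , x)

sort-≡ : ∀ {n} {x y x′ y′ : Fin n} → sort x y ≡ sort x′ y′ → (x ≡ x′ × y ≡ y′) ⊎ (x ≡ y′ × y ≡ x′)
sort-≡ {x = x} {y} {x′} {y′} with does (x Fin.<? y) | does (x′ Fin.<? y′)
... | true  | true  = inj₁ ∘ ,-injective
... | true  | false = inj₂ ∘ ,-injective
... | false | true  = inj₂ ∘ swap ∘ ,-injective
... | false | false = inj₁ ∘ swap ∘ ,-injective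

sort-< : ∀ {n} {x y : Fin n} → x Fin.< y → sort x y ≡ (x , y)
sort-< {x = x} {y} x<y rewrite dec-true (x Fin.<? y) x<y = refl

sort-> : ∀ {n} {x y : Fin n} → y Fin.< x → sort x y ≡ (y , x)
sort-> {x = x} {y} y<x rewrite dec-false (x Fin.<? y) (<-asym y<x) = refl

Inside : ∀ {n} → Pair n → Subset n → Set
Inside p A = proj₁ p ∈ₛ A × proj₂ p ∈ₛ A

Inside-sort : ∀ {n} {x y : Fin n} {A} → Inside (sort x y) A → x ∈ₛ A × y ∈ₛ A
Inside-sort {x = x} {y} with does (x Fin.<? y)
... | true  = id
... | false = swap

wlog-< : ∀ {n} {R : Rel (Fin n) ℓ} → Symmetric R → (∀ {x y} → x Fin.< y → R x y) →
         ∀ {x y} → x ≢ y → R x y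
wlog-< R-sym R< {x} {y} x≢y with <-cmp x y
... | tri< x<y _ _ = R< x<y
... | tri≈ _ x≡y _ = contradiction x≡y x≢y
... | tri> _ _ y<x = R-sym (R< y<x)

adj⇒≢ : ∀ {n} (G : Graph n) {x y} → adj G x y ≡ true → x ≢ y
adj⇒≢ G {x} xy refl = contradiction (trans (sym xy) (irrefl G x)) λ ()

module _ {n} (G : Graph n) where

  edgeList-unique : Unique (edgeList G)
  edgeList-unique = Unique.filter⁺ _ {allPairs n} (allPairs-unique n)

  ∈-edgeList⁺ : ∀ {x y} → x Fin.< y → adj G x y ≡ true → (x , y) ∈ edgeList G
  ∈-edgeList⁺ {x} {y} x<y xy =
    ∈-filter⁺ _ (∈-allPairs x y) (Equivalence.from T-∧ (fromWitness x<y , Equivalence.from T-≡ xy))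

  ∈-edgeList⁻ : ∀ {p} → p ∈ edgeList G → Ordered p × adj G (proj₁ p) (proj₂ p) ≡ true
  ∈-edgeList⁻ p∈ with ordered , xy ← Equivalence.to T-∧ (proj₂ (∈-filter⁻ _ {xs = allPairs n} p∈)) =
    toWitness ordered , Equivalence.to T-≡ xy

  edgeAt-ordered : ∀ e → Ordered (edgeAt G e)
  edgeAt-ordered e = proj₁ (∈-edgeList⁻ (∈-lookup e))

  edgeAt-adj : ∀ e → adj G (proj₁ (edgeAt G e)) (proj₂ (edgeAt G e)) ≡ true
  edgeAt-adj e = proj₂ (∈-edgeList⁻ (∈-lookup e))

  edgeAt-injective : ∀ {e e′} → edgeAt G e ≡ edgeAt G e′ → e ≡ e′
  edgeAt-injective = lookup-injective edgeList-unique _ _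

  edgeAt-complete : ∀ {x y} → x Fin.< y → adj G x y ≡ true → ∃[ e ] edgeAt G e ≡ (x , y)
  edgeAt-complete x<y xy = let xy∈ = ∈-edgeList⁺ x<y xy in index xy∈ , sym (lookup-index xy∈)

edges⇒homomorphism : ∀ {k n} (F : Graph k) (G : Graph n) (i : Fin k → Fin n) →
  (∀ e → adj G (i (proj₁ (edgeAt F e))) (i (proj₂ (edgeAt F e))) ≡ true) →
  ∀ x y → adj F x y ≡ true → adj G (i x) (i y) ≡ true
edges⇒homomorphism F G i edge-adj x y xy = wlog-< R-sym ordered (adj⇒≢ F xy) xy
  where
  R : Fin _ → Fin _ → Set
  R x y = adj F x y ≡ true → adj G (i x) (i y) ≡ true
  R-sym : Symmetric R
  R-sym {x} {y} Rxy yx = trans (Graph.sym G (i y) (i x)) (Rxy (trans (Graph.sym F x y) yx))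
  ordered : ∀ {x y} → x Fin.< y → R x y
  ordered x<y xy with e , refl ← edgeAt-complete F x<y xy = edge-adj e

module _ {n} (G : Graph n) (S : Subset n) where

  private
    clique-pair : Fin n → Fin n → Bool
    clique-pair x y = not (memb x S) ∨ not (memb y S) ∨ ⌊ x Fin.≟ y ⌋ ∨ adj G x y

  isClique⁻ : isClique G S ≡ true → ∀ {x y} → x ∈ₛ S → y ∈ₛ S → x ≢ y → adj G x y ≡ true
  isClique⁻ cl {x} {y} x∈S y∈S x≢y = pair (Equivalence.to T-≡ (All.lookup row (∈-allFin y)))
    where
    row : All (T ∘ clique-pair x) (allFin n)
    row = all⁺ _ (allFin n) (All.lookup (all⁺ _ (allFin n) (Equivalence.from T-≡ cl)) (∈-allFin x))
    pair : clique-pair x y ≡ true → adj G x y ≡ true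
    pair rewrite []=⇒lookup x∈S | []=⇒lookup y∈S with x Fin.≟ y
    ... | yes x≡y = contradiction x≡y x≢y
    ... | no _    = id

  isClique⁺ : (∀ {x y} → x ∈ₛ S → y ∈ₛ S → x ≢ y → adj G x y ≡ true) → isClique G S ≡ true
  isClique⁺ clique = Equivalence.to T-≡ (all⁻ _ (All.universal row (allFin n)))
    where
    pair : ∀ x y → clique-pair x y ≡ true
    pair x y with memb x S in x∈ | memb y S in y∈ | x Fin.≟ y
    ... | false | _     | _       = refl
    ... | true  | false | _       = refl
    ... | true  | true  | yes _   = refl
    ... | true  | true  | no x≢y = clique (lookup⇒[]= x S x∈) (lookup⇒[]= y S y∈) x≢y
    row : ∀ x → T (all (clique-pair x) (allFin n))
    row x = all⁻ _ (All.universal (λ y → Equivalence.from T-≡ (pair x y)) (allFin n))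

module _ {n} {P : Pred (Pair n) p} (P? : Decidable P) where

  pairGraph : Graph n
  pairGraph = record
    { adj    = adjacent
    ; sym    = λ x y → ∨-comm (⌊ x Fin.<? y ⌋ ∧ ⌊ P? (x , y) ⌋) _
    ; irrefl = λ x → cong (λ b → (b ∧ ⌊ P? (x , x) ⌋) ∨ (b ∧ ⌊ P? (x , x) ⌋))
                          (trans (isYes≗does (x Fin.<? x)) (dec-false (x Fin.<? x) (<-irrefl refl))) }
    where
    adjacent : Fin n → Fin n → Bool
    adjacent x y = (⌊ x Fin.<? y ⌋ ∧ ⌊ P? (x , y) ⌋) ∨ (⌊ y Fin.<? x ⌋ ∧ ⌊ P? (y , x) ⌋)

  pairGraph-adj⁺ : ∀ {x y} → x Fin.< y → P (x , y) → adj pairGraph x y ≡ true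
  pairGraph-adj⁺ {x} {y} x<y Pxy =
    Equivalence.to T-≡ (Equivalence.from (T-∨ {⌊ x Fin.<? y ⌋ ∧ ⌊ P? (x , y) ⌋}) (inj₁ (Equivalence.from T-∧
      (fromWitness {a? = x Fin.<? y} x<y , fromWitness {a? = P? (x , y)} Pxy))))

  pairGraph-adj⁻ : ∀ {x y} → adj pairGraph x y ≡ true → P (sort x y)
  pairGraph-adj⁻ {x} {y} xy with Equivalence.to T-∨ (Equivalence.from T-≡ xy)
  ... | inj₁ xy′ = let x<y , Pxy = Equivalence.to T-∧ xy′ in
    subst P (sym (sort-< (toWitness {a? = x Fin.<? y} x<y))) (toWitness {a? = P? (x , y)} Pxy)
  ... | inj₂ yx′ = let y<x , Pyx = Equivalence.to T-∧ yx′ in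
    subst P (sym (sort-> (toWitness {a? = y Fin.<? x} y<x))) (toWitness {a? = P? (y , x)} Pyx)

  length-filter-pairs≤numEdges : length (filter P? (pairs n)) ≤ numEdges pairGraph
  length-filter-pairs≤numEdges = Unique-⊆⇒length≤ (Unique.filter⁺ P? (pairs-unique n)) edge
    where
    edge : filter P? (pairs n) ⊆ edgeList pairGraph
    edge p∈ with p∈pairs , Pp ← ∈-filter⁻ P? p∈ =
      ∈-edgeList⁺ pairGraph (∈-pairs⁻ p∈pairs) (pairGraph-adj⁺ (∈-pairs⁻ p∈pairs) Pp)

  isClique-pairGraph : ∀ {S} → (∀ {x y} → x Fin.< y → x ∈ₛ S → y ∈ₛ S → P (x , y)) →
                       isClique pairGraph S ≡ true
  isClique-pairGraph {S} P-in-S = isClique⁺ pairGraph S λ x∈S y∈S x≢y → wlog-< R-sym R< x≢y x∈S y∈S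
    where
    R : Fin n → Fin n → Set
    R x y = x ∈ₛ S → y ∈ₛ S → adj pairGraph x y ≡ true
    R-sym : Symmetric R
    R-sym {x} {y} Rxy y∈S x∈S = trans (Graph.sym pairGraph y x) (Rxy x∈S y∈S)
    R< : ∀ {x y} → x Fin.< y → R x y
    R< x<y x∈S y∈S = pairGraph-adj⁺ x<y (P-in-S x<y x∈S y∈S)

-- Clique hypergraphs

allSubsets-unique : ∀ n → Unique (allSubsets n)
allSubsets-unique ℕ.zero = [] ∷ []
allSubsets-unique (ℕ.suc n) =
  Unique.++⁺ (Unique.map⁺ ∷-injectiveʳ (allSubsets-unique n))
             (Unique.map⁺ ∷-injectiveʳ (allSubsets-unique n)) disjoint
  where
  disjoint : ∀ {S} → ¬ (S ∈ map (inside Vec.∷_) (allSubsets n) × S ∈ map (outside Vec.∷_) (allSubsets n))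
  disjoint (S∈ , S∈′) with ∈-map⁻ (inside Vec.∷_) S∈ | ∈-map⁻ (outside Vec.∷_) S∈′
  ... | _ , _ , refl | _ , _ , ()

∈-allSubsets : ∀ {n} (S : Subset n) → S ∈ allSubsets n
∈-allSubsets Vec.[] = here refl
∈-allSubsets (true Vec.∷ S) = ∈-++⁺ˡ (∈-map⁺ (inside Vec.∷_) (∈-allSubsets S))
∈-allSubsets (false Vec.∷ S) = ∈-++⁺ʳ _ (∈-map⁺ (outside Vec.∷_) (∈-allSubsets S))

module _ {n} (r : ℕ) (G : Graph n) where

  isCliqueOfSize : Subset n → Bool
  isCliqueOfSize S = ⌊ ∣ S ∣ ℕ.≟ r ⌋ ∧ isClique G S

  cliques : List (Subset n)
  cliques = filterᵇ isCliqueOfSize (allSubsets n)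

  ∈-cliques⁺ : ∀ {S} → ∣ S ∣ ≡ r → isClique G S ≡ true → S ∈ cliques
  ∈-cliques⁺ {S} size clique = ∈-filter⁺ (T? ∘ isCliqueOfSize) (∈-allSubsets S)
    (Equivalence.from T-∧ (fromWitness size , Equivalence.from T-≡ clique))

  ∈-cliques⁻ : ∀ {S} → S ∈ cliques → ∣ S ∣ ≡ r × isClique G S ≡ true
  ∈-cliques⁻ S∈
    with size , clique ← Equivalence.to T-∧ (proj₂ (∈-filter⁻ (T? ∘ isCliqueOfSize) {xs = allSubsets n} S∈)) =
    toWitness size , Equivalence.to T-≡ clique

  cliqueHypergraph : UHyp n r
  cliqueHypergraph = record
    { hedges   = cliques
    ; distinct = Unique.filter⁺ (T? ∘ isCliqueOfSize) (allSubsets-unique n)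
    ; uniform  = All.tabulate (proj₁ ∘ ∈-cliques⁻) }

cliqueHypergraph-heavy-free : ∀ {k n t} r (F : Graph k) (G : Graph n) → 1 ≤ t →
                              ¬ ContainsGraph F G → ¬ ContainsHeavy t F (cliqueHypergraph r G)
cliqueHypergraph-heavy-free r F G t≥1 F⊈G (E , i , h , E⊆cliques , _ , i-inj , heavy) =
  F⊈G (i , i-inj , edges⇒homomorphism F G i edge-adj)
  where
  edge-adj : ∀ e → adj G (i (proj₁ (edgeAt F e))) (i (proj₂ (edgeAt F e))) ≡ true
  edge-adj e with |h|≡t , _ , h⊆E , ends ← heavy e
             with A , A∈E , x∈A , y∈A ← All⇒∃ (subst (0 <_) (sym |h|≡t) t≥1) (All.zip (h⊆E , ends)) =
    isClique⁻ G A (proj₂ (∈-cliques⁻ r G (All.lookup E⊆cliques A∈E))) x∈A y∈A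
      (λ ix≡iy → adj⇒≢ F (edgeAt-adj F e) (i-inj ix≡iy))

Berge⇒heavy : ∀ {k n r} t (F : Graph k) (H : UHyp n r) → ContainsBerge t F H → ContainsHeavy t F H
Berge⇒heavy _ _ _ (E , i , h , copy , _) = E , i , h , copy

-- Greedy assignment of hyperedges to pairs

module Greedy (n t : ℕ) where

  open Occurrences (_≟ₚ_ {n})

  Assignment : Set
  Assignment = List (Pair n × Subset n)

  load : Assignment → Pair n → ℕ
  load M p = count p (map proj₁ M)

  Saturated : Assignment → Subset n → Set
  Saturated M A = ∀ p → p ∈ pairs n → Inside p A → t ≤ load M p

  record Split (hs : List (Subset n)) : Set where
    field
      assigned             : Assignment
      unassigned           : List (Subset n)
      length-hs            : length hs ≡ length assigned + length unassigned
      assigned-inside      : All (λ z → proj₁ z ∈ pairs n × Inside (proj₁ z) (proj₂ z)) assigned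
      load≤t               : ∀ p → load assigned p ≤ t
      unassigned-saturated : All (Saturated assigned) unassigned
      assigned-unique      : Unique (map proj₂ assigned)
      unassigned-unique    : Unique unassigned
      assigned-⊆           : map proj₂ assigned ⊆ hs
      unassigned-⊆         : unassigned ⊆ hs

  empty : Split []
  empty = record
    { assigned = [] ; unassigned = [] ; length-hs = refl ; assigned-inside = [] ; load≤t = λ _ → z≤n
    ; unassigned-saturated = [] ; assigned-unique = [] ; unassigned-unique = []
    ; assigned-⊆ = λ () ; unassigned-⊆ = λ () }

  module Extend {A hs} (A∉hs : All (A ≢_) hs) (s : Split hs) where

    open Split s

    fresh : ∀ {xs} → xs ⊆ hs → All (A ≢_) xs
    fresh xs⊆hs = All.tabulate (All.lookup A∉hs ∘ xs⊆hs)

    assign : ∀ p → p ∈ pairs n → Inside p A → load assigned p < t → Split (A ∷ hs)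
    assign p p∈pairs p⊆A p<t = record
      { assigned             = (p , A) ∷ assigned
      ; unassigned           = unassigned
      ; length-hs            = cong ℕ.suc length-hs
      ; assigned-inside      = (p∈pairs , p⊆A) ∷ assigned-inside
      ; load≤t               = load≤t′
      ; unassigned-saturated = All.map (λ sat q q∈ q⊆ → ≤-trans (sat q q∈ q⊆) (count-≤-∷ q p _))
                                       unassigned-saturated
      ; assigned-unique      = fresh assigned-⊆ ∷ assigned-unique
      ; unassigned-unique    = unassigned-unique
      ; assigned-⊆           = ∷⁺ʳ A assigned-⊆
      ; unassigned-⊆         = ⊆-trans unassigned-⊆ (xs⊆x∷xs hs A) }
      where
      load≤t′ : ∀ q → load ((p , A) ∷ assigned) q ≤ t
      load≤t′ q with p ≟ₚ q
      ... | yes refl = p<t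
      ... | no _     = load≤t q

    leave : Saturated assigned A → Split (A ∷ hs)
    leave A-saturated = record
      { assigned             = assigned
      ; unassigned           = A ∷ unassigned
      ; length-hs            = trans (cong ℕ.suc length-hs) (sym (+-suc _ _))
      ; assigned-inside      = assigned-inside
      ; load≤t               = load≤t
      ; unassigned-saturated = A-saturated ∷ unassigned-saturated
      ; assigned-unique      = assigned-unique
      ; unassigned-unique    = fresh unassigned-⊆ ∷ unassigned-unique
      ; assigned-⊆           = ⊆-trans assigned-⊆ (xs⊆x∷xs hs A)
      ; unassigned-⊆         = ∷⁺ʳ A unassigned-⊆ }

    extend : Split (A ∷ hs)
    extend with any? (λ p → (proj₁ p ∈ₛ? A ×-dec proj₂ p ∈ₛ? A) ×-dec load assigned p <? t) (pairs n)
    ... | yes available = let p , p∈pairs , p⊆A , p<t = find available in assign p p∈pairs p⊆A p<t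
    ... | no unavailable = leave λ p p∈pairs p⊆A → ≮⇒≥ λ p<t → unavailable (lose p∈pairs (p⊆A , p<t))

  greedy : ∀ hs → Unique hs → Split hs
  greedy [] [] = empty
  greedy (A ∷ hs) (A∉hs ∷ u) = Extend.extend A∉hs (greedy hs u)

-- The graph of saturated pairs

module SaturatedPairs {n r} (t : ℕ) (H : UHyp n r) where

  open Greedy n t
  open Occurrences (_≟ₚ_ {n})
  open Split (greedy (hedges H) (distinct H))

  saturated? : Decidable (λ p → t ≤ load assigned p)
  saturated? p = t ≤? load assigned p

  saturatedGraph : Graph n
  saturatedGraph = pairGraph saturated?

  length-unassigned≤ : length unassigned ≤ numCliques r saturatedGraph
  length-unassigned≤ = Unique-⊆⇒length≤ unassigned-unique λ {A} A∈ →
    ∈-cliques⁺ r saturatedGraph (All.lookup (uniform H) (unassigned-⊆ A∈))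
      (isClique-pairGraph saturated? λ x<y x∈A y∈A →
        All.lookup unassigned-saturated A∈ _ (∈-pairs⁺ x<y) (x∈A , y∈A))

  length-assigned≤ : 1 ≤ t → length assigned ≤ numEdges saturatedGraph + (t ∸ 1) * (n C 2)
  length-assigned≤ t≥1 = begin
    length assigned                                      ≡⟨ length-map proj₁ assigned ⟨
    length (map proj₁ assigned)                          ≡⟨ sum-count (pairs-unique n) keys∈pairs ⟨
    sum (map (load assigned) (pairs n))                  ≤⟨ sum-map-mono load≤ (pairs n) ⟩
    sum (map (λ p → indicator (does (saturated? p)) + (t ∸ 1)) (pairs n))
      ≡⟨ sum-map-+ (λ p → indicator (does (saturated? p))) (λ _ → t ∸ 1) (pairs n) ⟩
    sum (map (λ p → indicator (does (saturated? p))) (pairs n)) + sum (map (λ _ → t ∸ 1) (pairs n))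
      ≡⟨ cong₂ _+_ (length-filter≡sum saturated? (pairs n)) (sym (sum-map-const (t ∸ 1) (pairs n))) ⟨
    length (filter saturated? (pairs n)) + length (pairs n) * (t ∸ 1)
      ≤⟨ +-mono-≤ (length-filter-pairs≤numEdges saturated?)
                  (≤-reflexive (trans (cong (_* (t ∸ 1)) (length-pairs n)) (*-comm (n C 2) (t ∸ 1)))) ⟩
    numEdges saturatedGraph + (t ∸ 1) * (n C 2)          ∎
    where
    open ≤-Reasoning
    keys∈pairs : All (_∈ pairs n) (map proj₁ assigned)
    keys∈pairs = All-map⁺ (All.map proj₁ assigned-inside)
    load≤ : ∀ p → load assigned p ≤ indicator (does (saturated? p)) + (t ∸ 1)
    load≤ p with saturated? p
    ... | yes t≤ rewrite dec-true (saturated? p) t≤ =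
      ≤-trans (load≤t p) (≤-reflexive (sym (m+[n∸m]≡n t≥1)))
    ... | no t≰ rewrite dec-false (saturated? p) t≰ = <⇒≤pred (≰⇒> t≰)

  length-hedges≤ : 1 ≤ t →
    length (hedges H) ≤ numCliques r saturatedGraph + numEdges saturatedGraph + (t ∸ 1) * (n C 2)
  length-hedges≤ t≥1 = begin
    length (hedges H)                   ≡⟨ length-hs ⟩
    length assigned + length unassigned ≡⟨ +-comm (length assigned) _ ⟩
    length unassigned + length assigned ≤⟨ +-mono-≤ length-unassigned≤ (length-assigned≤ t≥1) ⟩
    numCliques r saturatedGraph + (numEdges saturatedGraph + (t ∸ 1) * (n C 2))
      ≡⟨ +-assoc (numCliques r saturatedGraph) _ _ ⟨
    numCliques r saturatedGraph + numEdges saturatedGraph + (t ∸ 1) * (n C 2) ∎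
    where open ≤-Reasoning

  hyperedgesAt : Pair n → List (Subset n)
  hyperedgesAt p = map proj₂ (filter (λ z → proj₁ z ≟ₚ p) assigned)

  length-hyperedgesAt : ∀ p → length (hyperedgesAt p) ≡ load assigned p
  length-hyperedgesAt p = trans (length-map proj₂ (filter (λ z → proj₁ z ≟ₚ p) assigned))
    (sym (length-filter-map (_≟ₚ p) (λ z → proj₁ z ≟ₚ p) proj₁ (λ _ → refl) assigned))

  hyperedgesAt-unique : ∀ p → Unique (hyperedgesAt p)
  hyperedgesAt-unique p = Unique-map-filter (λ z → proj₁ z ≟ₚ p) proj₂ assigned-unique

  hyperedgesAt-⊆ : ∀ {p A} → A ∈ hyperedgesAt p → A ∈ hedges H
  hyperedgesAt-⊆ {p} A∈ with _ , z∈ , refl , _ ← ∈-map∘filter⁻ proj₂ (λ z → proj₁ z ≟ₚ p) A∈ =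
    assigned-⊆ (∈-map⁺ proj₂ z∈)

  hyperedgesAt-inside : ∀ {p A} → A ∈ hyperedgesAt p → Inside p A
  hyperedgesAt-inside {p} A∈ with _ , z∈ , refl , refl ← ∈-map∘filter⁻ proj₂ (λ z → proj₁ z ≟ₚ p) A∈ =
    proj₂ (All.lookup assigned-inside z∈)

  hyperedgesAt-disjoint : ∀ {p q A} → A ∈ hyperedgesAt p → A ∈ hyperedgesAt q → p ≡ q
  hyperedgesAt-disjoint {p} {q} A∈p A∈q
    with _ , z∈ , refl , refl ← ∈-map∘filter⁻ proj₂ (λ z → proj₁ z ≟ₚ p) A∈p
       | _ , z′∈ , z₂≡z′₂ , refl ← ∈-map∘filter⁻ proj₂ (λ z → proj₁ z ≟ₚ q) A∈q =
    cong proj₁ (Unique-map-injective proj₂ assigned-unique z∈ z′∈ z₂≡z′₂)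

  module _ {k} {F : Graph k} (φ : Fin k → Fin n) (φ-injective : Injective _≡_ _≡_ φ)
           (φ-hom : ∀ x y → adj F x y ≡ true → adj saturatedGraph (φ x) (φ y) ≡ true) where

    edgePair : Fin (numEdges F) → Pair n
    edgePair e = sort (φ (proj₁ (edgeAt F e))) (φ (proj₂ (edgeAt F e)))

    edgePair-injective : ∀ {e e′} → edgePair e ≡ edgePair e′ → e ≡ e′
    edgePair-injective {e} {e′} eq with sort-≡ eq
    ... | inj₁ (x≡x′ , y≡y′) = edgeAt-injective F (cong₂ _,_ (φ-injective x≡x′) (φ-injective y≡y′))
    ... | inj₂ (x≡y′ , y≡x′) = ⊥-elim (<-asym (edgeAt-ordered F e)
          (subst₂ Fin._<_ (sym (φ-injective y≡x′)) (sym (φ-injective x≡y′)) (edgeAt-ordered F e′)))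

    load-edgePair : ∀ e → load assigned (edgePair e) ≡ t
    load-edgePair e = ≤-antisym (load≤t _) (pairGraph-adj⁻ saturated? (φ-hom _ _ (edgeAt-adj F e)))

    h : Fin (numEdges F) → List (Subset n)
    h e = hyperedgesAt (edgePair e)

    length-h : ∀ e → length (h e) ≡ t
    length-h e = trans (length-hyperedgesAt (edgePair e)) (load-edgePair e)

    E : List (Subset n)
    E = concatMap h (allFin (numEdges F))

    E-⊆ : All (_∈ hedges H) E
    E-⊆ = All-concat⁺ (All-map⁺ (All.universal (λ _ → All.tabulate hyperedgesAt-⊆) (allFin (numEdges F))))

    h-disjoint : ∀ e e′ → e ≢ e′ → ∀ A → A ∈ h e → ¬ A ∈ h e′
    h-disjoint e e′ e≢e′ A A∈e A∈e′ = e≢e′ (edgePair-injective (hyperedgesAt-disjoint A∈e A∈e′))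

    E-unique : Unique E
    E-unique = Unique.concat⁺
      (All-map⁺ (All.universal (hyperedgesAt-unique ∘ edgePair) (allFin (numEdges F))))
      (AllPairs.map⁺ (AllPairs.tabulate⁺ λ {e} {e′} e≢e′ (A∈e , A∈e′) → h-disjoint e e′ e≢e′ _ A∈e A∈e′))

    length-E : length E ≡ t * numEdges F
    length-E = begin
      length E                                   ≡⟨ length-concatMap h length-h (allFin (numEdges F)) ⟩
      length (allFin (numEdges F)) * t           ≡⟨ cong (_* t) (length-tabulate {n = numEdges F} id) ⟩
      numEdges F * t                             ≡⟨ *-comm (numEdges F) t ⟩
      t * numEdges F                             ∎
      where open ≡-Reasoning

    bergeCopy : ContainsBerge t F H
    bergeCopy = E , φ , h ,
      ( E-⊆ , E-unique , φ-injective
      , λ e → length-h e , hyperedgesAt-unique (edgePair e)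
            , All.tabulate (λ A∈ → ∈-concat⁺′ A∈ (∈-map⁺ h (∈-allFin e)))
            , All.tabulate (Inside-sort ∘ hyperedgesAt-inside) )
      , length-E , h-disjoint

  saturatedGraph-F-free : ∀ {k} (F : Graph k) → ¬ ContainsBerge t F H → ¬ ContainsGraph F saturatedGraph
  saturatedGraph-F-free F no-copy (φ , φ-injective , φ-hom) = no-copy (bergeCopy {F = F} φ φ-injective φ-hom)

proposition5 : (r t k : ℕ) → 2 ≤ r → 1 ≤ t → (F : Graph k) → (n : ℕ) →
    (a b c d e : ℕ) →
    IsExClique n r F a → IsExHeavy n r t F b → IsExBerge n r t F c →
    IsEx n F d →
    a ≤ b × b ≤ c × c ≤ a + d + (t ∸ 1) * (n C 2)
proposition5 r t k _ t≥1 F n a b c d e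
  ((G , G-free , G-cliques) , a-max) ((H′ , H′-free , H′-size) , b-max) ((H , H-free , refl) , c-max)
  (_ , d-max) =
    b-max a (cliqueHypergraph r G , cliqueHypergraph-heavy-free r F G t≥1 G-free , G-cliques)
  , c-max b (H′ , H′-free ∘ Berge⇒heavy t F H′ , H′-size)
  , ≤-trans (length-hedges≤ t≥1) (+-monoˡ-≤ _ (+-mono-≤
      (a-max _ (saturatedGraph , saturated-F-free , refl))
      (d-max _ (saturatedGraph , saturated-F-free , refl))))
  where
  open SaturatedPairs t H
  saturated-F-free : ¬ ContainsGraph F saturatedGraph
  saturated-F-free = saturatedGraph-F-free F H-free
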